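{- For each formula $\alpha$ in the language of $\text{\L}^2$ there is a formula $\alpha^\star$ in $\neg$-negation normal form (built using $\rightarrow,{\sim},\triangle$ from literals $p$, $\neg p$) such that $$\vdash_{\text{\L}^2} \alpha \leftrightarrow \alpha^\star.$$
   Context: $\text{\L}^2$ has language $\alpha\coloneqq p\mid\alpha\rightarrow\beta\mid{\sim}\alpha\mid\triangle\alpha\mid\neg\alpha$ and is axiomatised by the \L{}ukasiewicz axioms for $\rightarrow,{\sim}$, the Baaz delta axioms and necessitation rule $\alpha\vdash\triangle\alpha$, modus ponens, the conflation rule $\alpha\vdash{\sim}\neg\alpha$, and the negation axioms $\neg\neg\alpha\leftrightarrow\alpha$, $\neg{\sim}\alpha\leftrightarrow{\sim}\neg\alpha$, $({\sim}\neg\alpha\rightarrow{\sim}\neg\beta)\leftrightarrow{\sim}\neg(\alpha\rightarrow\beta)$, $\neg\triangle\alpha\leftrightarrow{\sim}\triangle{\sim}\neg\alpha$ (where $\alpha\leftrightarrow\beta$ abbreviates $(\alpha\rightarrow\beta)\wedge(\beta\rightarrow\alpha)$ with $\wedge$ the \L{}ukasiewicz min-conjunction). -}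

module Defs where

open import Data.Nat using (ℕ)
open import Data.Product using (_×_)

infixr 5 _⇒_
data Fm : Set where
  var : ℕ → Fm
  _⇒_ : Fm → Fm → Fm
  ∼_  : Fm → Fm
  △_  : Fm → Fm
  ¬'_ : Fm → Fm

_∨'_ : Fm → Fm → Fm
α ∨' β = (α ⇒ β) ⇒ β

_∧'_ : Fm → Fm → Fm
α ∧' β = ∼ ((∼ α) ∨' (∼ β))

_⇔_ : Fm → Fm → Fm
α ⇔ β = (α ⇒ β) ∧' (β ⇒ α)

data ⊢_ : Fm → Set where
  Ł1 : ∀ α β → ⊢ (α ⇒ (β ⇒ α))
  Ł2 : ∀ α β γ → ⊢ ((α ⇒ β) ⇒ ((β ⇒ γ) ⇒ (α ⇒ γ)))
  Ł3 : ∀ α β → ⊢ (((α ⇒ β) ⇒ β) ⇒ ((β ⇒ α) ⇒ α))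
  Ł4 : ∀ α β → ⊢ ((∼ β ⇒ ∼ α) ⇒ (α ⇒ β))
  △1 : ∀ α → ⊢ ((△ α) ∨' (∼ (△ α)))
  △2 : ∀ α β → ⊢ (△ (α ∨' β) ⇒ ((△ α) ∨' (△ β)))
  △3 : ∀ α → ⊢ (△ α ⇒ α)
  △4 : ∀ α → ⊢ (△ α ⇒ △ (△ α))
  △5 : ∀ α β → ⊢ (△ (α ⇒ β) ⇒ (△ α ⇒ △ β))
  ¬¬  : ∀ α → ⊢ ((¬' (¬' α)) ⇔ α)
  ¬∼  : ∀ α → ⊢ ((¬' (∼ α)) ⇔ (∼ (¬' α)))
  ¬⇒  : ∀ α β → ⊢ (((∼ (¬' α)) ⇒ (∼ (¬' β))) ⇔ (∼ (¬' (α ⇒ β))))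
  ¬△  : ∀ α → ⊢ ((¬' (△ α)) ⇔ (∼ (△ (∼ (¬' α)))))
  mp    : ∀ {α β} → ⊢ α → ⊢ (α ⇒ β) → ⊢ β
  nec   : ∀ {α} → ⊢ α → ⊢ (△ α)
  confl : ∀ {α} → ⊢ α → ⊢ (∼ (¬' α))

data NNF : Fm → Set where
  lit-pos : ∀ n → NNF (var n)
  lit-neg : ∀ n → NNF (¬' (var n))
  nnf-⇒   : ∀ {α β} → NNF α → NNF β → NNF (α ⇒ β)
  nnf-∼   : ∀ {α} → NNF α → NNF (∼ α)
  nnf-△   : ∀ {α} → NNF α → NNF (△ α)

-- The negation axioms of Ł² are rewrite rules pushing ¬ through ∼, △ and ⇒,
-- and ¬¬ cancels.  There is no congruence rule for ¬, so the normal form of ¬α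
-- is computed directly, by a recursion on α simultaneous with that of α itself;
-- only congruence for ∼, △ and ⇒ is then needed, and that is derivable
-- (contraposition, necessitation with △5, suffixing and prefixing).
module Submission where

open import Defs
open import Data.Product using (Σ; _×_; _,_)

⇒-trans : ∀ {A B C} → ⊢ (A ⇒ B) → ⊢ (B ⇒ C) → ⊢ (A ⇒ C)
⇒-trans {A} {B} {C} p q = mp q (mp p (Ł2 A B C))

assertion : ∀ A B → ⊢ (A ⇒ ((A ⇒ B) ⇒ B))
assertion A B = ⇒-trans (Ł1 A (B ⇒ A)) (Ł3 B A)

⊤′ : Fm
⊤′ = var 0 ⇒ (var 0 ⇒ var 0)

⊢⊤′ : ⊢ ⊤′
⊢⊤′ = Ł1 (var 0) (var 0)

⊤′⇒-elim : ∀ A → ⊢ ((⊤′ ⇒ A) ⇒ A)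
⊤′⇒-elim A = mp ⊢⊤′ (assertion ⊤′ A)

⇒-refl : ∀ A → ⊢ (A ⇒ A)
⇒-refl A = ⇒-trans (Ł1 A ⊤′) (⊤′⇒-elim A)

⇒-exchange : ∀ A B C → ⊢ ((A ⇒ (B ⇒ C)) ⇒ (B ⇒ (A ⇒ C)))
⇒-exchange A B C =
  ⇒-trans (Ł2 A (B ⇒ C) C) (mp (assertion B C) (Ł2 B ((B ⇒ C) ⇒ C) (A ⇒ C)))

⇒-discharge : ∀ {A B C} → ⊢ B → ⊢ (A ⇒ (B ⇒ C)) → ⊢ (A ⇒ C)
⇒-discharge {A} {B} {C} b p = mp b (mp p (⇒-exchange A B C))

⇒-antitoneˡ : ∀ {A B} C → ⊢ (A ⇒ B) → ⊢ ((B ⇒ C) ⇒ (A ⇒ C))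
⇒-antitoneˡ {A} {B} C p = mp p (Ł2 A B C)

⇒-monotoneʳ : ∀ {A B} C → ⊢ (A ⇒ B) → ⊢ ((C ⇒ A) ⇒ (C ⇒ B))
⇒-monotoneʳ {A} {B} C p = ⇒-discharge p (Ł2 C A B)

∼-explosion : ∀ A B → ⊢ (∼ A ⇒ (A ⇒ B))
∼-explosion A B = ⇒-trans (Ł1 (∼ A) (∼ B)) (Ł4 A B)

∼∼-elim : ∀ A → ⊢ (∼ (∼ A) ⇒ A)
∼∼-elim A = ⇒-trans (∼-explosion (∼ A) (∼ ⊤′)) (⇒-trans (Ł4 ⊤′ A) (⊤′⇒-elim A))

∼∼-intro : ∀ A → ⊢ (A ⇒ ∼ (∼ A))
∼∼-intro A = mp (∼∼-elim (∼ A)) (Ł4 A (∼ (∼ A)))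

contraposition : ∀ {A B} → ⊢ (A ⇒ B) → ⊢ (∼ B ⇒ ∼ A)
contraposition {A} {B} p =
  mp (⇒-trans (∼∼-elim A) (⇒-trans p (∼∼-intro B))) (Ł4 (∼ B) (∼ A))

∧-elimˡ : ∀ {A B} → ⊢ (A ∧' B) → ⊢ A
∧-elimˡ {A} {B} p = mp (mp p (contraposition (assertion (∼ A) (∼ B)))) (∼∼-elim A)

∧-elimʳ : ∀ {A B} → ⊢ (A ∧' B) → ⊢ B
∧-elimʳ {A} {B} p = mp (mp p (contraposition (Ł1 (∼ B) (∼ A ⇒ ∼ B)))) (∼∼-elim B)

∧-intro : ∀ {A B} → ⊢ A → ⊢ B → ⊢ (A ∧' B)
∧-intro {A} {B} a b = mp (mp a (∼∼-intro A)) (contraposition ∼∨∼⇒∼A)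
  where
  ∼B⇒∼A : ⊢ (∼ B ⇒ ∼ A)
  ∼B⇒∼A = mp (mp b (∼∼-intro B)) (∼-explosion (∼ B) (∼ A))

  ∼∨∼⇒∼A : ⊢ (((∼ A) ∨' (∼ B)) ⇒ ∼ A)
  ∼∨∼⇒∼A = ⇒-discharge ∼B⇒∼A (Ł3 (∼ A) (∼ B))

infix 4 _≅_
_≅_ : Fm → Fm → Set
A ≅ B = ⊢ (A ⇒ B) × ⊢ (B ⇒ A)

⊢⇔⇒≅ : ∀ {A B} → ⊢ (A ⇔ B) → A ≅ B
⊢⇔⇒≅ p = ∧-elimˡ p , ∧-elimʳ p

≅⇒⊢⇔ : ∀ {A B} → A ≅ B → ⊢ (A ⇔ B)
≅⇒⊢⇔ (p , q) = ∧-intro p q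

≅-refl : ∀ A → A ≅ A
≅-refl A = ⇒-refl A , ⇒-refl A

≅-sym : ∀ {A B} → A ≅ B → B ≅ A
≅-sym (p , q) = q , p

≅-trans : ∀ {A B C} → A ≅ B → B ≅ C → A ≅ C
≅-trans (p , q) (r , s) = ⇒-trans p r , ⇒-trans s q

∼∼-≅ : ∀ A → A ≅ ∼ (∼ A)
∼∼-≅ A = ∼∼-intro A , ∼∼-elim A

∼-cong : ∀ {A B} → A ≅ B → ∼ A ≅ ∼ B
∼-cong (p , q) = contraposition q , contraposition p

△-cong : ∀ {A B} → A ≅ B → △ A ≅ △ B
△-cong {A} {B} (p , q) = mp (nec p) (△5 A B) , mp (nec q) (△5 B A)

⇒-cong : ∀ {A A′ B B′} → A ≅ A′ → B ≅ B′ → (A ⇒ B) ≅ (A′ ⇒ B′)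
⇒-cong {A} {A′} {B} {B′} (p , q) (r , s) =
  ⇒-trans (⇒-antitoneˡ B q) (⇒-monotoneʳ A′ r) ,
  ⇒-trans (⇒-antitoneˡ B′ p) (⇒-monotoneʳ A s)

nnf nnf¬ : Fm → Fm
nnf (var n) = var n
nnf (α ⇒ β) = nnf α ⇒ nnf β
nnf (∼ α)   = ∼ nnf α
nnf (△ α)   = △ nnf α
nnf (¬' α)  = nnf¬ α
nnf¬ (var n) = ¬' var n
nnf¬ (α ⇒ β) = ∼ ((∼ nnf¬ α) ⇒ (∼ nnf¬ β))
nnf¬ (∼ α)   = ∼ nnf¬ α
nnf¬ (△ α)   = ∼ (△ (∼ nnf¬ α))
nnf¬ (¬' α)  = nnf α

NNF-nnf  : ∀ α → NNF (nnf α)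
NNF-nnf¬ : ∀ α → NNF (nnf¬ α)
NNF-nnf (var n) = lit-pos n
NNF-nnf (α ⇒ β) = nnf-⇒ (NNF-nnf α) (NNF-nnf β)
NNF-nnf (∼ α)   = nnf-∼ (NNF-nnf α)
NNF-nnf (△ α)   = nnf-△ (NNF-nnf α)
NNF-nnf (¬' α)  = NNF-nnf¬ α
NNF-nnf¬ (var n) = lit-neg n
NNF-nnf¬ (α ⇒ β) = nnf-∼ (nnf-⇒ (nnf-∼ (NNF-nnf¬ α)) (nnf-∼ (NNF-nnf¬ β)))
NNF-nnf¬ (∼ α)   = nnf-∼ (NNF-nnf¬ α)
NNF-nnf¬ (△ α)   = nnf-∼ (nnf-△ (nnf-∼ (NNF-nnf¬ α)))
NNF-nnf¬ (¬' α)  = NNF-nnf α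

nnf-≅  : ∀ α → α ≅ nnf α
nnf¬-≅ : ∀ α → ¬' α ≅ nnf¬ α
nnf-≅ (var n) = ≅-refl (var n)
nnf-≅ (α ⇒ β) = ⇒-cong (nnf-≅ α) (nnf-≅ β)
nnf-≅ (∼ α)   = ∼-cong (nnf-≅ α)
nnf-≅ (△ α)   = △-cong (nnf-≅ α)
nnf-≅ (¬' α)  = nnf¬-≅ α
nnf¬-≅ (var n) = ≅-refl (¬' var n)
-- The axiom ¬⇒ only describes ∼¬(α ⇒ β), hence the detour through ∼∼.
nnf¬-≅ (α ⇒ β) =
  ≅-trans (∼∼-≅ (¬' (α ⇒ β)))
    (∼-cong (≅-trans (≅-sym (⊢⇔⇒≅ (¬⇒ α β)))
                     (⇒-cong (∼-cong (nnf¬-≅ α)) (∼-cong (nnf¬-≅ β)))))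
nnf¬-≅ (∼ α)   = ≅-trans (⊢⇔⇒≅ (¬∼ α)) (∼-cong (nnf¬-≅ α))
nnf¬-≅ (△ α)   = ≅-trans (⊢⇔⇒≅ (¬△ α)) (∼-cong (△-cong (∼-cong (nnf¬-≅ α))))
nnf¬-≅ (¬' α)  = ≅-trans (⊢⇔⇒≅ (¬¬ α)) (nnf-≅ α)

mainTheorem14 : (α : Fm) → Σ Fm (λ αstar → NNF αstar × (⊢ (α ⇔ αstar)))
mainTheorem14 α = nnf α , NNF-nnf α , ≅⇒⊢⇔ (nnf-≅ α)
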